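{- Let $G=(V,E)$ be a finite simple graph with a vertex cut $C$. Let $V_1$ be the vertex set of one of the connected components of $G-C$, let $V_2=V\setminus(V_1\cup C)$, and let $G_1=G[V_1\cup C]$ and $G_2=G[V_2\cup C]$. Then $$Z(G_1)+Z(G_2)-|C|\le Z(G)\le Z(G_1)+Z(G_2)+|C|.$$
   Context: Zero forcing: vertices are blue or white; a blue vertex $u$ may force (recolour blue) a white neighbour $v$ if $v$ is the only white vertex in $N[u]$. A zero forcing set of a graph is a set of vertices such that, starting with exactly these vertices blue and repeatedly applying this rule, all vertices eventually become blue. $Z(H)$ denotes the minimum size of a zero forcing set of a graph $H$. -}

module Defs where

open import Data.Nat using (ℕ; _≤_; _+_)
open import Data.Bool using (Bool; true; false)
open import Data.Fin using (Fin)
open import Data.Fin.Subset public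
  using (Subset; _∈_; _∉_; _⊆_; _∪_; ∁; ⁅_⁆; ∣_∣; ⊤)
open import Data.Product using (Σ; ∃; _×_; _,_)
open import Data.Sum using (_⊎_)
open import Relation.Nullary using (¬_)
open import Relation.Binary.PropositionalEquality using (_≡_; _≢_)
open import Relation.Binary.Construct.Closure.ReflexiveTransitive using (Star)
open import Function.Bundles using (_⇔_)

record Graph (n : ℕ) : Set where
  field
    adj    : Fin n → Fin n → Bool
    sym    : ∀ u v → adj u v ≡ adj v u
    irrefl : ∀ v → adj v v ≡ false
open Graph public

module _ {n : ℕ} (G : Graph n) where

  EdgeOutside : Subset n → Fin n → Fin n → Set
  EdgeOutside C a b = a ∉ C × b ∉ C × adj G a b ≡ true

  ReachOutside : Subset n → Fin n → Fin n → Set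
  ReachOutside C = Star (EdgeOutside C)

  IsVertexCut : Subset n → Set
  IsVertexCut C = Σ (Fin n) λ x → Σ (Fin n) λ y →
    x ∉ C × y ∉ C × ¬ ReachOutside C x y

  IsComponentOutside : Subset n → Subset n → Set
  IsComponentOutside C V₁ = Σ (Fin n) λ x → x ∉ C ×
    (∀ y → (y ∈ V₁) ⇔ (y ∉ C × ReachOutside C x y))

  -- Zero forcing in the induced subgraph G[U]:
  -- Derives U B S : starting from blue set B, the blue set S is obtainable
  -- by repeated applications of the colour-change rule in G[U].
  data Derives (U : Subset n) (B : Subset n) : Subset n → Set where
    start : Derives U B B
    force : ∀ {S} (u v : Fin n) → Derives U B S →
            u ∈ U → u ∈ S → v ∈ U → v ∉ S → adj G u v ≡ true →
            (∀ w → w ∈ U → adj G u w ≡ true → w ≢ v → w ∈ S) →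
            Derives U B (S ∪ ⁅ v ⁆)

  IsZeroForcingSet : Subset n → Subset n → Set
  IsZeroForcingSet U B = B ⊆ U × Σ (Subset n) λ S → Derives U B S × U ⊆ S

  IsZ : Subset n → ℕ → Set
  IsZ U m = (Σ (Subset n) λ B → IsZeroForcingSet U B × ∣ B ∣ ≡ m) ×
            (∀ B → IsZeroForcingSet U B → m ≤ ∣ B ∣)

-- Put U₁ = V₁ ∪ C and U₂ = V ∖ V₁. No edge joins U₁ ∖ C to U₂ ∖ C, so a force
-- u → v in G is a force of G[U₁] or of G[U₂], except when v ∈ C is forced from
-- U₂ ∖ C; in G[U₁] such vertices are taken as initially blue, and G[U₂] instead
-- starts with the remaining vertices of C. This splits a zero forcing set B of G
-- into zero forcing sets of G[U₁] and G[U₂] of total size at most |B| + |C|.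
-- Conversely, given zero forcing sets of G[U₁] and G[U₂], run the forces of
-- G[U₂] in G first: those from U₂ ∖ C stay valid, and each vertex of C forces at
-- most once, so making their targets blue from the start costs at most |C|.
-- Once U₂ is blue, every force of G[U₁] is valid in G.
module Submission where

open import Defs
open import Data.Nat using (ℕ; _≤_; _+_; suc; z≤n; s≤s)
open import Data.Product using (_×_; Σ; _,_; proj₂)
import Data.Product as Product
open import Data.Nat.Properties
  using (≤-refl; ≤-trans; +-mono-≤; +-monoʳ-≤; m≤n+m; +-identityʳ; +-comm; +-assoc;
         +-commutativeSemigroup; module ≤-Reasoning)
open import Algebra.Properties.CommutativeSemigroup +-commutativeSemigroup using (interchange)
open import Data.Bool using (Bool; true; false)
open import Data.Vec using ([]; _∷_; here)
open import Data.Fin using (Fin; zero) renaming (_≟_ to _≟ᶠ_)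
open import Data.Fin.Subset using (_∩_; ⊥)
open import Data.Fin.Subset.Properties
open import Data.Sum using (_⊎_; inj₁; inj₂; [_,_]′)
import Data.Sum as Sum
open import Data.Empty using (⊥-elim)
open import Relation.Nullary using (yes; no)
open import Relation.Binary.PropositionalEquality using (_≡_; _≢_; refl; trans; cong; cong₂)
open import Relation.Binary.Construct.Closure.ReflexiveTransitive using (ε; _◅_; _◅◅_)
open import Function.Bundles using (Equivalence)

module _ {n : ℕ} where

  ∪-lub : ∀ {p q r : Subset n} → p ⊆ r → q ⊆ r → p ∪ q ⊆ r
  ∪-lub {p} {q} p⊆r q⊆r x∈ = [ p⊆r , q⊆r ]′ (x∈p∪q⁻ p q x∈)

  ∪-mono : ∀ {p p′ q q′ : Subset n} → p ⊆ p′ → q ⊆ q′ → p ∪ q ⊆ p′ ∪ q′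
  ∪-mono {p′ = p′} {q′ = q′} p⊆p′ q⊆q′ =
    ∪-lub (λ x∈ → p⊆p∪q q′ (p⊆p′ x∈)) (λ x∈ → q⊆p∪q p′ q′ (q⊆q′ x∈))

  ⁅x⁆⊆p : ∀ {x} {p : Subset n} → x ∈ p → ⁅ x ⁆ ⊆ p
  ⁅x⁆⊆p {x} x∈p y∈ with x∈⁅y⁆⇒x≡y x y∈
  ... | refl = x∈p

  x∈p∪⁅x⁆ : ∀ {x} {p : Subset n} → x ∈ p ∪ ⁅ x ⁆
  x∈p∪⁅x⁆ {x} {p} = q⊆p∪q p ⁅ x ⁆ (x∈⁅x⁆ x)

  x∈p∪⁅y⁆⁻ : ∀ {x y} {p : Subset n} → x ∈ p ∪ ⁅ y ⁆ → x ∈ p ⊎ x ≡ y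
  x∈p∪⁅y⁆⁻ {y = y} {p} x∈ = Sum.map₂ (x∈⁅y⁆⇒x≡y y) (x∈p∪q⁻ p ⁅ y ⁆ x∈)

indicator : Bool → ℕ
indicator true  = 1
indicator false = 0

∣x∷p∣ : ∀ {n} x (p : Subset n) → ∣ x ∷ p ∣ ≡ indicator x + ∣ p ∣
∣x∷p∣ true  p = refl
∣x∷p∣ false p = refl

1≤indicator+indicator : ∀ {c d} → c ≡ true ⊎ d ≡ true → 1 ≤ indicator c + indicator d
1≤indicator+indicator (inj₁ refl) = s≤s z≤n
1≤indicator+indicator {c} (inj₂ refl) = m≤n+m 1 (indicator c)

indicator-+-mono : ∀ a b c d →
  (a ≡ true → b ≡ true → c ≡ true × d ≡ true) → (a ≡ true ⊎ b ≡ true → c ≡ true ⊎ d ≡ true) →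
  indicator a + indicator b ≤ indicator c + indicator d
indicator-+-mono false false c d _ _ = z≤n
indicator-+-mono true true c d both _ with both refl refl
... | refl , refl = ≤-refl
indicator-+-mono true false c d _ either = 1≤indicator+indicator (either (inj₁ refl))
indicator-+-mono false true c d _ either = 1≤indicator+indicator (either (inj₂ refl))

-- Pointwise, a + b ≤ c + d for bits a, b, c, d exactly when a ∧ b ≤ c ∧ d and a ∨ b ≤ c ∨ d.
∣p∣+∣q∣≤∣r∣+∣s∣ : ∀ {n} {p q r s : Subset n} → p ∩ q ⊆ r ∩ s → p ∪ q ⊆ r ∪ s →
  ∣ p ∣ + ∣ q ∣ ≤ ∣ r ∣ + ∣ s ∣
∣p∣+∣q∣≤∣r∣+∣s∣ {p = []} {[]} {[]} {[]} _ _ = z≤n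
∣p∣+∣q∣≤∣r∣+∣s∣ {p = a ∷ p} {b ∷ q} {c ∷ r} {d ∷ s} ∩⊆∩ ∪⊆∪ = begin
  ∣ a ∷ p ∣ + ∣ b ∷ q ∣
    ≡⟨ cong₂ _+_ (∣x∷p∣ a p) (∣x∷p∣ b q) ⟩
  (indicator a + ∣ p ∣) + (indicator b + ∣ q ∣)
    ≡⟨ interchange (indicator a) (∣ p ∣) (indicator b) (∣ q ∣) ⟩
  (indicator a + indicator b) + (∣ p ∣ + ∣ q ∣)
    ≤⟨ +-mono-≤ (indicator-+-mono a b c d heads-∩ heads-∪) tails ⟩
  (indicator c + indicator d) + (∣ r ∣ + ∣ s ∣)
    ≡⟨ interchange (indicator c) (indicator d) (∣ r ∣) (∣ s ∣) ⟩
  (indicator c + ∣ r ∣) + (indicator d + ∣ s ∣)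
    ≡⟨ cong₂ _+_ (∣x∷p∣ c r) (∣x∷p∣ d s) ⟨
  ∣ c ∷ r ∣ + ∣ d ∷ s ∣
    ∎
  where
  open ≤-Reasoning
  head : ∀ {x} {t : Subset _} → zero ∈ x ∷ t → x ≡ true
  head here = refl
  ∈head : ∀ {x} {t : Subset _} → x ≡ true → zero ∈ x ∷ t
  ∈head refl = here
  heads-∩ : a ≡ true → b ≡ true → c ≡ true × d ≡ true
  heads-∩ a≡ b≡ =
    Product.map head head (x∈p∩q⁻ (c ∷ r) (d ∷ s) (∩⊆∩ (x∈p∩q⁺ (∈head a≡ , ∈head b≡))))
  heads-∪ : a ≡ true ⊎ b ≡ true → c ≡ true ⊎ d ≡ true
  heads-∪ h = Sum.map head head (x∈p∪q⁻ (c ∷ r) (d ∷ s) (∪⊆∪ (x∈p∪q⁺ (Sum.map ∈head ∈head h))))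
  tails : ∣ p ∣ + ∣ q ∣ ≤ ∣ r ∣ + ∣ s ∣
  tails = ∣p∣+∣q∣≤∣r∣+∣s∣ (drop-∷-⊆ ∩⊆∩) (drop-∷-⊆ ∪⊆∪)

∣p∪q∣≤∣p∣+∣q∣ : ∀ {n} (p q : Subset n) → ∣ p ∪ q ∣ ≤ ∣ p ∣ + ∣ q ∣
∣p∪q∣≤∣p∣+∣q∣ {n} p q = begin
  ∣ p ∪ q ∣          ≡⟨ +-identityʳ _ ⟨
  ∣ p ∪ q ∣ + 0      ≡⟨ cong (∣ p ∪ q ∣ +_) (∣⊥∣≡0 n) ⟨
  ∣ p ∪ q ∣ + ∣ ⊥ {n} ∣  ≤⟨ ∣p∣+∣q∣≤∣r∣+∣s∣ {p = p ∪ q} {⊥} {p} {q}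
                              (λ x∈ → ⊥-elim (∉⊥ (proj₂ (x∈p∩q⁻ (p ∪ q) ⊥ x∈))))
                              (∪-lub ⊆-refl (λ x∈ → ⊥-elim (∉⊥ x∈))) ⟩
  ∣ p ∣ + ∣ q ∣      ∎
  where open ≤-Reasoning

∣p∪⁅x⁆∣≤1+∣p∣ : ∀ {n} (p : Subset n) x → ∣ p ∪ ⁅ x ⁆ ∣ ≤ suc ∣ p ∣
∣p∪⁅x⁆∣≤1+∣p∣ p x = begin
  ∣ p ∪ ⁅ x ⁆ ∣      ≤⟨ ∣p∪q∣≤∣p∣+∣q∣ p ⁅ x ⁆ ⟩
  ∣ p ∣ + ∣ ⁅ x ⁆ ∣  ≡⟨ cong (∣ p ∣ +_) (∣⁅x⁆∣≡1 x) ⟩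
  ∣ p ∣ + 1          ≡⟨ +-comm ∣ p ∣ 1 ⟩
  suc ∣ p ∣          ∎
  where open ≤-Reasoning

x∉p⇒1+∣p∣≤∣p∪⁅x⁆∣ : ∀ {n} (p : Subset n) {x} → x ∉ p → suc ∣ p ∣ ≤ ∣ p ∪ ⁅ x ⁆ ∣
x∉p⇒1+∣p∣≤∣p∪⁅x⁆∣ {n} p {x} x∉p = begin
  suc ∣ p ∣                ≡⟨ +-comm 1 ∣ p ∣ ⟩
  ∣ p ∣ + 1                ≡⟨ cong (∣ p ∣ +_) (∣⁅x⁆∣≡1 x) ⟨
  ∣ p ∣ + ∣ ⁅ x ⁆ ∣        ≤⟨ ∣p∣+∣q∣≤∣r∣+∣s∣ {p = p} {⁅ x ⁆} {p ∪ ⁅ x ⁆} {⊥} disjoint (p⊆p∪q ⊥) ⟩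
  ∣ p ∪ ⁅ x ⁆ ∣ + ∣ ⊥ {n} ∣  ≡⟨ cong (∣ p ∪ ⁅ x ⁆ ∣ +_) (∣⊥∣≡0 n) ⟩
  ∣ p ∪ ⁅ x ⁆ ∣ + 0        ≡⟨ +-identityʳ _ ⟩
  ∣ p ∪ ⁅ x ⁆ ∣            ∎
  where
  open ≤-Reasoning
  disjoint : p ∩ ⁅ x ⁆ ⊆ (p ∪ ⁅ x ⁆) ∩ ⊥
  disjoint y∈ with x∈p∩q⁻ p ⁅ x ⁆ y∈
  ... | y∈p , y∈⁅x⁆ with x∈⁅y⁆⇒x≡y x y∈⁅x⁆
  ...   | refl = ⊥-elim (x∉p y∈p)

module _ {n : ℕ} (G : Graph n) where

  Reaches : Subset n → Subset n → Subset n → Set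
  Reaches U B S = Σ (Subset n) λ T → Derives G U B T × S ⊆ T

  record CanForce (U S : Subset n) (u v : Fin n) : Set where
    field
      forcer∈U : u ∈ U
      forcer∈S : u ∈ S
      edge     : adj G u v ≡ true
      others∈S : ∀ w → w ∈ U → adj G u w ≡ true → w ≢ v → w ∈ S

  CanForce-∩ : ∀ {U S u v} → CanForce U S u v → CanForce U (S ∩ U) u v
  CanForce-∩ can = record
    { forcer∈U = forcer∈U
    ; forcer∈S = x∈p∩q⁺ (forcer∈S , forcer∈U)
    ; edge     = edge
    ; others∈S = λ w w∈U e w≢v → x∈p∩q⁺ (others∈S w w∈U e w≢v , w∈U)
    }
    where open CanForce can

  CanForce-⊤⇒ : ∀ {U S u v} → u ∈ U → CanForce ⊤ S u v → CanForce U S u v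
  CanForce-⊤⇒ u∈U can = record
    { forcer∈U = u∈U
    ; forcer∈S = forcer∈S
    ; edge     = edge
    ; others∈S = λ w _ → others∈S w ∈⊤
    }
    where open CanForce can

  Derives-initial⊆ : ∀ {U B S} → Derives G U B S → B ⊆ S
  Derives-initial⊆ start x∈ = x∈
  Derives-initial⊆ (force _ _ D _ _ _ _ _ _) x∈ = p⊆p∪q _ (Derives-initial⊆ D x∈)

  Reaches-refl : ∀ {U B} → Reaches U B B
  Reaches-refl {B = B} = B , start , ⊆-refl

  Reaches-⊆ : ∀ {U B S S′} → S′ ⊆ S → Reaches U B S → Reaches U B S′
  Reaches-⊆ S′⊆S (T , D , S⊆T) = T , D , λ x∈ → S⊆T (S′⊆S x∈)

  Reaches-initial : ∀ {U B B′ S} → B′ ⊆ B → Reaches U B S → Reaches U B (S ∪ B′)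
  Reaches-initial B′⊆B (T , D , S⊆T) = T , D , ∪-lub S⊆T (λ x∈ → Derives-initial⊆ D (B′⊆B x∈))

  Reaches-force : ∀ {U B S u v} → Reaches U B S → v ∈ U → CanForce U S u v →
    Reaches U B (S ∪ ⁅ v ⁆)
  Reaches-force {u = u} {v} (T , D , S⊆T) v∈U can with v ∈? T
  ... | yes v∈T = T , D , ∪-lub S⊆T (⁅x⁆⊆p v∈T)
  ... | no  v∉T = T ∪ ⁅ v ⁆ ,
        force u v D forcer∈U (S⊆T forcer∈S) v∈U v∉T edge
          (λ w w∈U e w≢v → S⊆T (others∈S w w∈U e w≢v)) ,
        ∪-mono S⊆T ⊆-refl
    where open CanForce can

  Derives⇒Reaches : ∀ {U B B′ S} → B ⊆ B′ → Derives G U B S → Reaches U B′ S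
  Derives⇒Reaches B⊆B′ start = _ , start , B⊆B′
  Derives⇒Reaches B⊆B′ (force u v D u∈U u∈S v∈U _ e others) =
    Reaches-force (Derives⇒Reaches B⊆B′ D) v∈U
      (record { forcer∈U = u∈U ; forcer∈S = u∈S ; edge = e ; others∈S = others })

  Reaches-monoˡ : ∀ {U B B′ S} → B ⊆ B′ → Reaches U B S → Reaches U B′ S
  Reaches-monoˡ B⊆B′ (T , D , S⊆T) = Reaches-⊆ S⊆T (Derives⇒Reaches B⊆B′ D)

  -- A force u → v of G, as seen by G[U].
  Reaches-extend : ∀ {U B S u v} → Reaches U B (S ∩ U) →
    (v ∈ U → v ∈ B ⊎ CanForce U S u v) → Reaches U B ((S ∪ ⁅ v ⁆) ∩ U)
  Reaches-extend {U} {B} {S} {u} {v} R step with v ∈? U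
  ... | no v∉U = Reaches-⊆ drop-v R
    where
    drop-v : (S ∪ ⁅ v ⁆) ∩ U ⊆ S ∩ U
    drop-v x∈ with x∈p∩q⁻ (S ∪ ⁅ v ⁆) U x∈
    ... | x∈S∪v , x∈U with x∈p∪⁅y⁆⁻ x∈S∪v
    ...   | inj₁ x∈S = x∈p∩q⁺ (x∈S , x∈U)
    ...   | inj₂ refl = ⊥-elim (v∉U x∈U)
  ... | yes v∈U = Reaches-⊆ split-v
        ([ (λ v∈B → Reaches-initial (⁅x⁆⊆p v∈B) R)
         , (λ can → Reaches-force R v∈U (CanForce-∩ can)) ]′ (step v∈U))
    where
    split-v : (S ∪ ⁅ v ⁆) ∩ U ⊆ (S ∩ U) ∪ ⁅ v ⁆
    split-v x∈ with x∈p∩q⁻ (S ∪ ⁅ v ⁆) U x∈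
    ... | x∈S∪v , x∈U with x∈p∪⁅y⁆⁻ x∈S∪v
    ...   | inj₁ x∈S = p⊆p∪q ⁅ v ⁆ (x∈p∩q⁺ (x∈S , x∈U))
    ...   | inj₂ refl = x∈p∪⁅x⁆

  record Separation (C U₁ U₂ : Subset n) : Set where
    field
      covers           : ∀ {x} → x ∉ U₁ → x ∈ U₂
      C⊆U₁             : C ⊆ U₁
      C⊆U₂             : C ⊆ U₂
      U₁∩U₂⊆C          : ∀ {x} → x ∈ U₁ → x ∈ U₂ → x ∈ C
      no-crossing-edge : ∀ {u w} → u ∉ U₁ → w ∉ U₂ → adj G u w ≢ true

  module _ {C U₁ U₂ : Subset n} (sep : Separation C U₁ U₂) where
    open Separation sep

    ∈U₁⊎∈U₂ : ∀ x → x ∈ U₁ ⊎ x ∈ U₂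
    ∈U₁⊎∈U₂ x with x ∈? U₁
    ... | yes x∈U₁ = inj₁ x∈U₁
    ... | no  x∉U₁ = inj₂ (covers x∉U₁)

    Separation-swap : Separation C U₂ U₁
    Separation-swap = record
      { covers           = λ {x} x∉U₂ →
                             [ (λ x∈U₁ → x∈U₁) , (λ x∈U₂ → ⊥-elim (x∉U₂ x∈U₂)) ]′ (∈U₁⊎∈U₂ x)
      ; C⊆U₁             = C⊆U₂
      ; C⊆U₂             = C⊆U₁
      ; U₁∩U₂⊆C          = λ x∈U₂ x∈U₁ → U₁∩U₂⊆C x∈U₁ x∈U₂
      ; no-crossing-edge = λ {u} {w} u∉U₂ w∉U₁ e → no-crossing-edge w∉U₁ u∉U₂ (trans (sym G w u) e)
      }

    neighbour-of-∉U₁ : ∀ {u w} → u ∉ U₁ → adj G u w ≡ true → w ∈ U₂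
    neighbour-of-∉U₁ {u} {w} u∉U₁ e with w ∈? U₂
    ... | yes w∈U₂ = w∈U₂
    ... | no  w∉U₂ = ⊥-elim (no-crossing-edge u∉U₁ w∉U₂ e)

  module _ {C U₁ U₂ : Subset n} (sep : Separation C U₁ U₂) where
    open Separation sep

    -- X collects the vertices that G[U₂] forces from C; such a force can be blocked in G
    -- by a white neighbour in U₁, so X is made blue from the start. F is the set of
    -- forcers in C, each of which has no white neighbour left in U₂.
    record ReplayOfU₂ (B₂ S : Subset n) : Set where
      field
        X F     : Subset n
        F⊆C     : F ⊆ C
        ∣X∣≤∣F∣ : ∣ X ∣ ≤ ∣ F ∣
        F-spent : ∀ {c} → c ∈ F → ∀ w → w ∈ U₂ → adj G c w ≡ true → w ∈ S
        reaches : Reaches ⊤ (B₂ ∪ X) S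

    replayU₂ : ∀ {B₂ S} → Derives G U₂ B₂ S → ReplayOfU₂ B₂ S
    replayU₂ {B₂} start = record
      { X = ⊥ ; F = ⊥ ; F⊆C = ⊥⊆ ; ∣X∣≤∣F∣ = ≤-refl
      ; F-spent = λ c∈⊥ → ⊥-elim (∉⊥ c∈⊥)
      ; reaches = Reaches-⊆ (p⊆p∪q ⊥) Reaches-refl
      }
    replayU₂ {B₂} (force {S} u v D u∈U₂ u∈S v∈U₂ v∉S e others) with u ∈? C
    ... | yes u∈C = record
      { X = X ∪ ⁅ v ⁆ ; F = F ∪ ⁅ u ⁆
      ; F⊆C = ∪-lub F⊆C (⁅x⁆⊆p u∈C)
      ; ∣X∣≤∣F∣ = ≤-trans (∣p∪⁅x⁆∣≤1+∣p∣ X v) (≤-trans (s≤s ∣X∣≤∣F∣) (x∉p⇒1+∣p∣≤∣p∪⁅x⁆∣ F u∉F))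
      ; F-spent = F∪u-spent
      ; reaches = Reaches-initial (⁅x⁆⊆p (q⊆p∪q B₂ _ x∈p∪⁅x⁆))
                    (Reaches-monoˡ (∪-mono ⊆-refl (p⊆p∪q ⁅ v ⁆)) reaches)
      }
      where
      open ReplayOfU₂ (replayU₂ D)
      u∉F : u ∉ F
      u∉F u∈F = v∉S (F-spent u∈F v v∈U₂ e)
      F∪u-spent : ∀ {c} → c ∈ F ∪ ⁅ u ⁆ → ∀ w → w ∈ U₂ → adj G c w ≡ true → w ∈ S ∪ ⁅ v ⁆
      F∪u-spent c∈ w w∈U₂ e′ with x∈p∪⁅y⁆⁻ c∈
      ... | inj₁ c∈F = p⊆p∪q ⁅ v ⁆ (F-spent c∈F w w∈U₂ e′)
      ... | inj₂ refl with w ≟ᶠ v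
      ...   | yes refl = x∈p∪⁅x⁆
      ...   | no  w≢v  = p⊆p∪q ⁅ v ⁆ (others w w∈U₂ e′ w≢v)
    ... | no u∉C = record
      { X = X ; F = F ; F⊆C = F⊆C ; ∣X∣≤∣F∣ = ∣X∣≤∣F∣
      ; F-spent = λ c∈F w w∈U₂ e′ → p⊆p∪q ⁅ v ⁆ (F-spent c∈F w w∈U₂ e′)
      ; reaches = Reaches-force reaches ∈⊤ (record
          { forcer∈U = ∈⊤ ; forcer∈S = u∈S ; edge = e
          ; others∈S = λ w _ e′ w≢v → others w (neighbour-of-∉U₁ sep u∉U₁ e′) e′ w≢v })
      }
      where
      open ReplayOfU₂ (replayU₂ D)
      u∉U₁ : u ∉ U₁
      u∉U₁ u∈U₁ = u∉C (U₁∩U₂⊆C u∈U₁ u∈U₂)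

    replayU₁ : ∀ {B B₁ S} → Reaches ⊤ B (U₂ ∪ B₁) → Derives G U₁ B₁ S → Reaches ⊤ B (U₂ ∪ S)
    replayU₁ R start = R
    replayU₁ R (force {S} u v D u∈U₁ u∈S v∈U₁ _ e others) =
      Reaches-⊆ (∪-lub (λ x∈ → p⊆p∪q ⁅ v ⁆ (p⊆p∪q S x∈)) (∪-mono (q⊆p∪q U₂ S) ⊆-refl))
        (Reaches-force (replayU₁ R D) ∈⊤ (record
          { forcer∈U = ∈⊤ ; forcer∈S = q⊆p∪q U₂ S u∈S ; edge = e ; others∈S = others∈U₂∪S }))
      where
      others∈U₂∪S : ∀ w → w ∈ ⊤ → adj G u w ≡ true → w ≢ v → w ∈ U₂ ∪ S
      others∈U₂∪S w _ e′ w≢v =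
        [ (λ w∈U₁ → q⊆p∪q U₂ S (others w w∈U₁ e′ w≢v)) , p⊆p∪q S ]′ (∈U₁⊎∈U₂ sep w)

    glue : ∀ {B₁ B₂} → IsZeroForcingSet G U₁ B₁ → IsZeroForcingSet G U₂ B₂ →
      Σ (Subset n) λ X → ∣ X ∣ ≤ ∣ C ∣ × IsZeroForcingSet G ⊤ (B₁ ∪ B₂ ∪ X)
    glue {B₁} {B₂} (_ , S₁ , D₁ , U₁⊆S₁) (_ , S₂ , D₂ , U₂⊆S₂) =
      X , ≤-trans ∣X∣≤∣F∣ (p⊆q⇒∣p∣≤∣q∣ F⊆C) , ⊆⊤ , Reaches-⊆ everything (replayU₁ U₂∪B₁ D₁)
      where
      open ReplayOfU₂ (replayU₂ D₂)
      U₂∪B₁ : Reaches ⊤ (B₁ ∪ B₂ ∪ X) (U₂ ∪ B₁)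
      U₂∪B₁ = Reaches-initial (p⊆p∪q (B₂ ∪ X))
                (Reaches-⊆ U₂⊆S₂ (Reaches-monoˡ (q⊆p∪q B₁ (B₂ ∪ X)) reaches))
      everything : ⊤ ⊆ U₂ ∪ S₁
      everything {x} _ = [ (λ x∈U₁ → q⊆p∪q U₂ S₁ (U₁⊆S₁ x∈U₁)) , p⊆p∪q S₁ ]′ (∈U₁⊎∈U₂ sep x)

    Z-upper : ∀ {z z₁ z₂} → IsZ G ⊤ z → IsZ G U₁ z₁ → IsZ G U₂ z₂ → z ≤ z₁ + z₂ + ∣ C ∣
    Z-upper {z} (_ , minimal) ((B₁ , zfs₁ , refl) , _) ((B₂ , zfs₂ , refl) , _)
      with glue zfs₁ zfs₂
    ... | X , ∣X∣≤∣C∣ , zfs = begin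
      z                              ≤⟨ minimal _ zfs ⟩
      ∣ B₁ ∪ B₂ ∪ X ∣                ≤⟨ ∣p∪q∣≤∣p∣+∣q∣ B₁ (B₂ ∪ X) ⟩
      ∣ B₁ ∣ + ∣ B₂ ∪ X ∣            ≤⟨ +-monoʳ-≤ ∣ B₁ ∣ (∣p∪q∣≤∣p∣+∣q∣ B₂ X) ⟩
      ∣ B₁ ∣ + (∣ B₂ ∣ + ∣ X ∣)      ≡⟨ +-assoc (∣ B₁ ∣) (∣ B₂ ∣) (∣ X ∣) ⟨
      ∣ B₁ ∣ + ∣ B₂ ∣ + ∣ X ∣        ≤⟨ +-monoʳ-≤ (∣ B₁ ∣ + ∣ B₂ ∣) ∣X∣≤∣C∣ ⟩
      ∣ B₁ ∣ + ∣ B₂ ∣ + ∣ C ∣        ∎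
      where open ≤-Reasoning

    leftover : Subset n → Subset n → Subset n
    leftover S Y = C ∩ S ∩ ∁ Y

    leftover-mono : ∀ {S S′ Y Y′} → S ⊆ S′ → (∀ {c} → c ∈ S → c ∈ Y′ → c ∈ Y) →
      leftover S Y ⊆ leftover S′ Y′
    leftover-mono {S} {Y = Y} S⊆S′ Y′∩S⊆Y c∈ with x∈p∩q⁻ C (S ∩ ∁ Y) c∈
    ... | c∈C , c∈S∖Y with x∈p∩q⁻ S (∁ Y) c∈S∖Y
    ...   | c∈S , c∈∁Y = x∈p∩q⁺ (c∈C , x∈p∩q⁺ (S⊆S′ c∈S ,
                           x∉p⇒x∈∁p (λ c∈Y′ → x∈∁p⇒x∉p c∈∁Y (Y′∩S⊆Y c∈S c∈Y′))))

    -- Y is the set of vertices of C forced in G from outside U₁: G[U₁] takes them as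
    -- initially blue, and G[U₂] takes the other blue vertices of C (the leftover).
    record SplitOf (B S : Subset n) : Set where
      field
        Y        : Subset n
        Y⊆C      : Y ⊆ C
        Y⊆S      : Y ⊆ S
        reaches₁ : Reaches U₁ ((B ∩ U₁) ∪ Y) (S ∩ U₁)
        reaches₂ : Reaches U₂ ((B ∩ U₂) ∪ leftover S Y) (S ∩ U₂)

    split-start : ∀ {B} → SplitOf B B
    split-start = record
      { Y = ⊥ ; Y⊆C = ⊥⊆ ; Y⊆S = ⊥⊆
      ; reaches₁ = Reaches-⊆ (p⊆p∪q ⊥) Reaches-refl
      ; reaches₂ = Reaches-⊆ (p⊆p∪q _) Reaches-refl
      }

    split-force-into-C : ∀ {B S u v} → SplitOf B S → v ∉ S → v ∈ C → u ∉ U₁ →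
      CanForce ⊤ S u v → SplitOf B (S ∪ ⁅ v ⁆)
    split-force-into-C {B} {S} {u} {v} sp v∉S v∈C u∉U₁ can = record
      { Y = Y ∪ ⁅ v ⁆
      ; Y⊆C = ∪-lub Y⊆C (⁅x⁆⊆p v∈C)
      ; Y⊆S = ∪-mono Y⊆S ⊆-refl
      ; reaches₁ = Reaches-extend {u = u} (Reaches-monoˡ (∪-mono ⊆-refl (p⊆p∪q ⁅ v ⁆)) reaches₁)
                     (λ _ → inj₁ (q⊆p∪q (B ∩ U₁) _ x∈p∪⁅x⁆))
      ; reaches₂ = Reaches-extend
                     (Reaches-monoˡ (∪-mono ⊆-refl (leftover-mono (p⊆p∪q ⁅ v ⁆) v-new)) reaches₂)
                     (λ _ → inj₂ (CanForce-⊤⇒ (covers u∉U₁) can))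
      }
      where
      open SplitOf sp
      v-new : ∀ {c} → c ∈ S → c ∈ Y ∪ ⁅ v ⁆ → c ∈ Y
      v-new c∈S c∈ with x∈p∪⁅y⁆⁻ c∈
      ... | inj₁ c∈Y = c∈Y
      ... | inj₂ refl = ⊥-elim (v∉S c∈S)

    split-force-inward : ∀ {B S u v} → SplitOf B S → v ∉ S → (v ∈ C → u ∈ U₁) →
      CanForce ⊤ S u v → SplitOf B (S ∪ ⁅ v ⁆)
    split-force-inward {B} {S} {u} {v} sp v∉S inward can = record
      { Y = Y ; Y⊆C = Y⊆C ; Y⊆S = λ y∈ → p⊆p∪q ⁅ v ⁆ (Y⊆S y∈)
      ; reaches₁ = Reaches-extend reaches₁ (λ v∈U₁ → inj₂ (CanForce-⊤⇒ (u∈U₁ v∈U₁) can))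
      ; reaches₂ = Reaches-extend
                     (Reaches-monoˡ (∪-mono ⊆-refl (leftover-mono (p⊆p∪q ⁅ v ⁆) λ _ c∈Y → c∈Y)) reaches₂)
                     in-U₂
      }
      where
      open SplitOf sp
      open CanForce can
      u∈U₁ : v ∈ U₁ → u ∈ U₁
      u∈U₁ v∈U₁ with u ∈? U₁
      ... | yes u∈U₁ = u∈U₁
      ... | no  u∉U₁ = inward (U₁∩U₂⊆C v∈U₁ (neighbour-of-∉U₁ sep u∉U₁ edge))
      -- Forced from U₁ ∖ C, a vertex of C ∖ Y is initially blue in G[U₂].
      in-U₂ : v ∈ U₂ → v ∈ (B ∩ U₂) ∪ leftover (S ∪ ⁅ v ⁆) Y ⊎ CanForce U₂ S u v
      in-U₂ v∈U₂ with u ∈? U₂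
      ... | yes u∈U₂ = inj₂ (CanForce-⊤⇒ u∈U₂ can)
      ... | no  u∉U₂ = inj₁ (q⊆p∪q (B ∩ U₂) _ (x∈p∩q⁺ (v∈C , x∈p∩q⁺ (x∈p∪⁅x⁆ , v∉Y))))
        where
        v∈C : v ∈ C
        v∈C = U₁∩U₂⊆C (neighbour-of-∉U₁ (Separation-swap sep) u∉U₂ edge) v∈U₂
        v∉Y : v ∈ ∁ Y
        v∉Y = x∉p⇒x∈∁p (λ v∈Y → v∉S (Y⊆S v∈Y))

    split-force : ∀ {B S u v} → SplitOf B S → v ∉ S → CanForce ⊤ S u v → SplitOf B (S ∪ ⁅ v ⁆)
    split-force {u = u} {v} sp v∉S can with v ∈? C | u ∈? U₁
    ... | yes v∈C | no  u∉U₁ = split-force-into-C sp v∉S v∈C u∉U₁ can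
    ... | yes _   | yes u∈U₁ = split-force-inward sp v∉S (λ _ → u∈U₁) can
    ... | no  v∉C | _        = split-force-inward sp v∉S (λ v∈C → ⊥-elim (v∉C v∈C)) can

    split : ∀ {B S} → Derives G ⊤ B S → SplitOf B S
    split start = split-start
    split (force u v D _ u∈S _ v∉S e others) = split-force (split D) v∉S
      (record { forcer∈U = ∈⊤ ; forcer∈S = u∈S ; edge = e ; others∈S = others })

    split-zfs : ∀ {B} → IsZeroForcingSet G ⊤ B → Σ (Subset n) λ Y → Y ⊆ C ×
      IsZeroForcingSet G U₁ ((B ∩ U₁) ∪ Y) × IsZeroForcingSet G U₂ ((B ∩ U₂) ∪ (C ∩ ∁ Y))
    split-zfs {B} (_ , S , D , ⊤⊆S) =
      Y , Y⊆C ,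
      (∪-lub (p∩q⊆q B U₁) (λ y∈ → C⊆U₁ (Y⊆C y∈)) , Reaches-⊆ (all-of U₁) reaches₁) ,
      (∪-lub (p∩q⊆q B U₂) (λ c∈ → C⊆U₂ (p∩q⊆p C (∁ Y) c∈)) ,
       Reaches-⊆ (all-of U₂) (Reaches-monoˡ (∪-mono ⊆-refl leftover⊆) reaches₂))
      where
      open SplitOf (split D)
      all-of : ∀ U → U ⊆ S ∩ U
      all-of U x∈U = x∈p∩q⁺ (⊤⊆S ∈⊤ , x∈U)
      leftover⊆ : leftover S Y ⊆ C ∩ ∁ Y
      leftover⊆ c∈ = x∈p∩q⁺ (p∩q⊆p C _ c∈ , p∩q⊆q S (∁ Y) (p∩q⊆q C _ c∈))

    ∣split∣ : ∀ {B Y} → Y ⊆ C → ∣ (B ∩ U₁) ∪ Y ∣ + ∣ (B ∩ U₂) ∪ (C ∩ ∁ Y) ∣ ≤ ∣ B ∣ + ∣ C ∣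
    ∣split∣ {B} {Y} Y⊆C = ∣p∣+∣q∣≤∣r∣+∣s∣ in-both in-either
      where
      in-both : ((B ∩ U₁) ∪ Y) ∩ ((B ∩ U₂) ∪ (C ∩ ∁ Y)) ⊆ B ∩ C
      in-both x∈ with x∈p∩q⁻ ((B ∩ U₁) ∪ Y) _ x∈
      ... | x∈₁ , x∈₂ with x∈p∪q⁻ (B ∩ U₁) Y x∈₁ | x∈p∪q⁻ (B ∩ U₂) (C ∩ ∁ Y) x∈₂
      ...   | inj₁ x∈B∩U₁ | inj₁ x∈B∩U₂ =
              x∈p∩q⁺ (p∩q⊆p B U₁ x∈B∩U₁ , U₁∩U₂⊆C (p∩q⊆q B U₁ x∈B∩U₁) (p∩q⊆q B U₂ x∈B∩U₂))
      ...   | inj₁ x∈B∩U₁ | inj₂ x∈C∖Y = x∈p∩q⁺ (p∩q⊆p B U₁ x∈B∩U₁ , p∩q⊆p C (∁ Y) x∈C∖Y)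
      ...   | inj₂ x∈Y    | inj₁ x∈B∩U₂ = x∈p∩q⁺ (p∩q⊆p B U₂ x∈B∩U₂ , Y⊆C x∈Y)
      ...   | inj₂ x∈Y    | inj₂ x∈C∖Y = ⊥-elim (x∈∁p⇒x∉p (p∩q⊆q C (∁ Y) x∈C∖Y) x∈Y)
      in-either : ((B ∩ U₁) ∪ Y) ∪ ((B ∩ U₂) ∪ (C ∩ ∁ Y)) ⊆ B ∪ C
      in-either =
        ∪-lub (∪-lub (λ x∈ → p⊆p∪q C (p∩q⊆p B U₁ x∈)) (λ x∈ → q⊆p∪q B C (Y⊆C x∈)))
              (∪-lub (λ x∈ → p⊆p∪q C (p∩q⊆p B U₂ x∈)) (λ x∈ → q⊆p∪q B C (p∩q⊆p C (∁ Y) x∈)))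

    Z-lower : ∀ {z z₁ z₂} → IsZ G ⊤ z → IsZ G U₁ z₁ → IsZ G U₂ z₂ → z₁ + z₂ ≤ z + ∣ C ∣
    Z-lower ((B , zfs , refl) , _) (_ , minimal₁) (_ , minimal₂) with split-zfs zfs
    ... | Y , Y⊆C , zfs₁ , zfs₂ =
      ≤-trans (+-mono-≤ (minimal₁ _ zfs₁) (minimal₂ _ zfs₂)) (∣split∣ {B} Y⊆C)

module _ {n : ℕ} (G : Graph n) {C V₁ : Subset n} (component : IsComponentOutside G C V₁) where

  component-closed : ∀ {a b} → a ∈ V₁ → b ∉ C → adj G a b ≡ true → b ∈ V₁
  component-closed {a} {b} a∈V₁ b∉C e =
    let members   = proj₂ (proj₂ component)
        a∉C , x⇝a = Equivalence.to (members a) a∈V₁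
    in Equivalence.from (members b) (b∉C , x⇝a ◅◅ ((a∉C , b∉C , e) ◅ ε))

  component-separation : Separation G C (V₁ ∪ C) (∁ (V₁ ∪ C) ∪ C)
  component-separation = record
    { covers           = λ x∉U₁ → p⊆p∪q C (x∉p⇒x∈∁p x∉U₁)
    ; C⊆U₁             = q⊆p∪q V₁ C
    ; C⊆U₂             = q⊆p∪q (∁ (V₁ ∪ C)) C
    ; U₁∩U₂⊆C          = λ x∈U₁ x∈U₂ →
        [ (λ x∈∁U₁ → ⊥-elim (x∈∁p⇒x∉p x∈∁U₁ x∈U₁)) , (λ x∈C → x∈C) ]′ (x∈p∪q⁻ (∁ (V₁ ∪ C)) C x∈U₂)
    ; no-crossing-edge = no-crossing-edge
    }
    where
    no-crossing-edge : ∀ {u w} → u ∉ V₁ ∪ C → w ∉ ∁ (V₁ ∪ C) ∪ C → adj G u w ≢ true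
    no-crossing-edge {u} {w} u∉U₁ w∉U₂ e with w ∈? V₁
    ... | yes w∈V₁ = u∉U₁ (p⊆p∪q C (component-closed w∈V₁ (λ u∈C → u∉U₁ (q⊆p∪q V₁ C u∈C))
                                       (trans (sym G w u) e)))
    ... | no  w∉V₁ = w∉U₂ (p⊆p∪q C (x∉p⇒x∈∁p λ w∈U₁ →
                       [ w∉V₁ , (λ w∈C → w∉U₂ (q⊆p∪q (∁ (V₁ ∪ C)) C w∈C)) ]′ (x∈p∪q⁻ V₁ C w∈U₁)))

proposition3p7 : ∀ {n : ℕ} (G : Graph n) (C V₁ : Subset n) →
    IsVertexCut G C →
    IsComponentOutside G C V₁ →
    ∀ (z z₁ z₂ : ℕ) →
    IsZ G ⊤ z →
    IsZ G (V₁ ∪ C) z₁ →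
    IsZ G (∁ (V₁ ∪ C) ∪ C) z₂ →
    (z₁ + z₂ ≤ z + ∣ C ∣) × (z ≤ z₁ + z₂ + ∣ C ∣)
proposition3p7 G C V₁ _ component z z₁ z₂ Z Z₁ Z₂ =
  Z-lower G separation Z Z₁ Z₂ , Z-upper G separation Z Z₁ Z₂
  where
  separation : Separation G C (V₁ ∪ C) (∁ (V₁ ∪ C) ∪ C)
  separation = component-separation G component
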